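{- For every integer $n\ge0$ and $\beta\in\mathbb{C}$, as linear maps on polynomials of degree at most $n$, $$U_nE^{n\beta}U_n^{ -1}=V_n^{ -1}B_{n\beta}V_n,$$ where $B_{n\beta}$ is the linear map $x^p\mapsto\sum_{i=0}^{p}\binom{n\beta}{p-i}x^i$ (the transpose of the Riordan matrix $((1+x)^{n\beta},x)$).
   Context: Polynomials over $\mathbb{C}$; $\binom{y}{k}=y(y-1)\cdots(y-k+1)/k!$. $U_nx^p=\frac{(1-x)^{n+1}}{n!}\sum_{m\ge0}m^px^m$ ($0\le p\le n$, $0^0=1$), inverse $U_n^{ -1}x^p=(x)_p[x+1]_{n-p}$ with $(y)_p=y(y-1)\cdots(y-p+1)$, $[y]_k=y(y+1)\cdots(y+k-1)$. $E^{\gamma}c(x)=c(x+\gamma)$. $V_nc(x)=(1+x)^nc\big(\frac{x}{1+x}\big)$, $V_n^{ -1}c(x)=(1-x)^nc\big(\frac{x}{1-x}\big)$. -}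

module Defs where

open import Algebra.Bundles using (CommutativeRing)
open import Data.Nat using (ℕ; zero; suc; _∸_; _≤ᵇ_)
open import Data.Nat.Combinatorics using (_C_)
open import Data.Bool using (if_then_else_)

-- Polynomial operators over a commutative ring R, given a function `inv`
-- meant to supply inverses of the positive integers (R a ℚ-algebra,
-- e.g. ℂ).  Polynomials are coefficient sequences ℕ → R (coefficient of x^k).
-- Operators on P_n (degree ≤ n) read only the coefficients 0..n of their input
-- and extend linearly from the monomial basis.
module Ops {c ℓ} (R : CommutativeRing c ℓ)
           (inv : ℕ → CommutativeRing.Carrier R) where
  open CommutativeRing R

  Poly : Set c
  Poly = ℕ → Carrier

  natR : ℕ → Carrier
  natR zero = 0#
  natR (suc m) = 1# + natR m

  pow : Carrier → ℕ → Carrier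
  pow x zero = 1#
  pow x (suc q) = x * pow x q

  sumLt : ℕ → (ℕ → Carrier) → Carrier
  sumLt zero f = 0#
  sumLt (suc m) f = sumLt m f + f m

  sumTo : ℕ → (ℕ → Carrier) → Carrier
  sumTo m f = sumLt (suc m) f

  invFact : ℕ → Carrier
  invFact zero = 1#
  invFact (suc m) = inv (suc m) * invFact m

  fallR : Carrier → ℕ → Carrier
  fallR y zero = 1#
  fallR y (suc k) = fallR y k * (y - natR k)

  binom : Carrier → ℕ → Carrier
  binom y k = fallR y k * invFact k

  constP : Carrier → Poly
  constP a zero = a
  constP a (suc k) = 0#

  X : Poly
  X zero = 0#
  X (suc zero) = 1#
  X (suc (suc k)) = 0#

  _⊕_ : Poly → Poly → Poly
  (f ⊕ g) k = f k + g k

  _⊗_ : Poly → Poly → Poly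
  (f ⊗ g) k = sumTo k (λ i → f i * g (k ∸ i))

  scale : Carrier → Poly → Poly
  scale a f k = a * f k

  powP : Poly → ℕ → Poly
  powP f zero = constP 1#
  powP f (suc q) = f ⊗ powP f q

  sumP : ℕ → (ℕ → Poly) → Poly
  sumP m F k = sumTo m (λ q → F q k)

  fallP : ℕ → Poly
  fallP zero = constP 1#
  fallP (suc p) = fallP p ⊗ (X ⊕ constP (- natR p))

  riseP1 : ℕ → Poly
  riseP1 zero = constP 1#
  riseP1 (suc k) = riseP1 k ⊗ (X ⊕ constP (natR (suc k)))

  -- U_n x^q = (1-x)^{n+1}/n! Σ_{m≥0} m^q x^m ; the coefficient of x^k of
  -- (1-x)^{n+1} Σ_m m^q x^m is Σ_{j=0}^{k} (-1)^j C(n+1,j) (k-j)^q  (0^0 = 1)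
  Umono : ℕ → ℕ → Poly
  Umono n q k = invFact n *
    sumTo k (λ j → pow (- 1#) j * natR (suc n C j) * pow (natR (k ∸ j)) q)

  U : ℕ → Poly → Poly
  U n c = sumP n (λ q → scale (c q) (Umono n q))

  Uinv : ℕ → Poly → Poly
  Uinv n c = sumP n (λ p → scale (c p) (fallP p ⊗ riseP1 (n ∸ p)))

  E : ℕ → Carrier → Poly → Poly
  E n γ c = sumP n (λ q → scale (c q) (powP (X ⊕ constP γ) q))

  -- V_n c(x) = (1+x)^n c(x/(1+x)) = Σ_q c_q x^q (1+x)^{n-q}
  V : ℕ → Poly → Poly
  V n c = sumP n (λ q → scale (c q)
            (powP X q ⊗ powP (constP 1# ⊕ X) (n ∸ q)))

  -- V_n^{-1} c(x) = (1-x)^n c(x/(1-x)) = Σ_q c_q x^q (1-x)^{n-q}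
  Vinv : ℕ → Poly → Poly
  Vinv n c = sumP n (λ q → scale (c q)
               (powP X q ⊗ powP (constP 1# ⊕ scale (- 1#) X) (n ∸ q)))

  Bmono : Carrier → ℕ → Poly
  Bmono γ p i = if i ≤ᵇ p then binom γ (p ∸ i) else 0#

  B : ℕ → Carrier → Poly → Poly
  B n γ c = sumP n (λ p → scale (c p) (Bmono γ p))

-- Both sides send x^p to Σ_i binom(γ + n - p, n - i) x^i (1-x)^(n-i), where γ = nβ.
-- On the right, V_n x^p = x^p (1+x)^(n-p), and B_γ turns it, by Vandermonde's identity,
-- into Σ_i binom(γ + n - p, n - i) x^i; then V_n^{-1} x^i = x^i (1-x)^(n-i).
-- On the left, E^γ U_n^{-1} x^p = (x+γ)_p [x+γ+1]_(n-p) = n! binom(x + γ + n - p, n).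
-- U_n reads a polynomial g through its values, as (1-x)^(n+1)/n! Σ_m g(m) x^m; expanding
-- binom(m + a, n) = Σ_l binom(a, l) binom(m, n - l) and using
-- Σ_m binom(m, s) x^m = x^s / (1-x)^(s+1) gives the same polynomial.

module Submission where

open import Defs

open import Algebra.Bundles using (CommutativeRing; RawRing)
open import Data.Nat as ℕ using (ℕ; zero; suc; pred; _∸_; _≤_; _<_; z≤n; s≤s)
open import Data.Nat.Properties as ℕ using ()
open import Data.Nat.Combinatorics using (_C_; k>n⇒nCk≡0; nCk≡nC[n∸k]; nCk+nC[k+1]≡[n+1]C[k+1])
open import Data.Bool using (true; false)
open import Data.Empty using (⊥-elim)
open import Data.Sum using (inj₁; inj₂)
open import Data.Maybe using (Maybe; just; nothing)
open import Data.Product using (_×_; _,_)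
open import Data.Product.Properties using (≡-dec)
import Relation.Binary.PropositionalEquality as ≡
open ≡ using (_≡_)
open import Relation.Nullary using (yes; no)
open import Algebra.Solver.Ring.AlmostCommutativeRing
  using (_-Raw-AlmostCommutative⟶_; fromCommutativeRing)

-- Integers are pairs (a , b) standing for a - b.  The operations return pairs
-- with a zero component, so that equal coefficients are equal pairs.
module IntegerCoefficientSolver {c ℓ} (R : CommutativeRing c ℓ) where
  open CommutativeRing R
  open import Algebra.Properties.Ring ring using (-0#≈0#; [y-z]x≈yx-zx; x[y-z]≈xy-xz)
  open import Algebra.Properties.AbelianGroup +-abelianGroup using (⁻¹-∙-comm; ⁻¹-anti-homo‿-)
  open import Algebra.Properties.CommutativeSemigroup +-commutativeSemigroup using (interchange)
  open import Algebra.Properties.Semiring.Mult.TCOptimised semiring using (×-homo-+; ×1-homo-*)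
    renaming (_×_ to _×′_)
  open import Relation.Binary.Reasoning.Setoid setoid

  private
    normalise : ℕ → ℕ → ℕ × ℕ
    normalise a b = a ∸ b , b ∸ a

    _+ℤ_ _*ℤ_ : ℕ × ℕ → ℕ × ℕ → ℕ × ℕ
    (a , b) +ℤ (a′ , b′) = normalise (a ℕ.+ a′) (b ℕ.+ b′)
    (a , b) *ℤ (a′ , b′) = normalise (a ℕ.* a′ ℕ.+ b ℕ.* b′) (a ℕ.* b′ ℕ.+ b ℕ.* a′)

    -ℤ_ : ℕ × ℕ → ℕ × ℕ
    -ℤ (a , b) = b , a

    ℤ-rawRing : RawRing _ _
    ℤ-rawRing = record
      { Carrier = ℕ × ℕ ; _≈_ = _≡_ ; _+_ = _+ℤ_ ; _*_ = _*ℤ_ ; -_ = -ℤ_ ; 0# = 0 , 0 ; 1# = 1 , 0 }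

    ι : ℕ → Carrier
    ι a = a ×′ 1#

    -- Chosen so that (0 , 0), (1 , 0) and (0 , 1) denote 0#, 1# and - 1# on the nose,
    -- which lets solved identities be stated with these constants.
    ⟦_⟧ : ℕ × ℕ → Carrier
    ⟦ a , zero ⟧ = ι a
    ⟦ zero , suc b ⟧ = - ι (suc b)
    ⟦ suc a , suc b ⟧ = ⟦ a , b ⟧

    ⟦normalise⟧ : ∀ a b → ⟦ normalise a b ⟧ ≈ ⟦ a , b ⟧
    ⟦normalise⟧ zero zero = refl
    ⟦normalise⟧ zero (suc b) = refl
    ⟦normalise⟧ (suc a) zero = refl
    ⟦normalise⟧ (suc a) (suc b) = ⟦normalise⟧ a b

    ⟦⟧-difference : ∀ a b → ⟦ a , b ⟧ ≈ ι a - ι b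
    ⟦⟧-difference a zero = sym (trans (+-congˡ -0#≈0#) (+-identityʳ _))
    ⟦⟧-difference zero (suc b) = sym (+-identityˡ _)
    ⟦⟧-difference (suc a) (suc b) = begin
      ⟦ a , b ⟧                    ≈⟨ ⟦⟧-difference a b ⟩
      ι a - ι b                    ≈⟨ +-identityˡ _ ⟨
      0# + (ι a - ι b)             ≈⟨ +-congʳ (-‿inverseʳ 1#) ⟨
      (1# - 1#) + (ι a - ι b)      ≈⟨ interchange _ _ _ _ ⟩
      (1# + ι a) + (- 1# - ι b)    ≈⟨ +-congˡ (⁻¹-∙-comm _ _) ⟩
      (1# + ι a) - (1# + ι b)      ≈⟨ +-cong (×-homo-+ 1# 1 a) (-‿cong (×-homo-+ 1# 1 b)) ⟨
      ι (suc a) - ι (suc b)        ∎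

    ⟦normalise⟧-difference : ∀ a b → ⟦ normalise a b ⟧ ≈ ι a - ι b
    ⟦normalise⟧-difference a b = trans (⟦normalise⟧ a b) (⟦⟧-difference a b)

    difference-+ : ∀ x y x′ y′ → (x - y) + (x′ - y′) ≈ (x + x′) - (y + y′)
    difference-+ x y x′ y′ = trans (interchange _ _ _ _) (+-congˡ (⁻¹-∙-comm _ _))

    difference-* : ∀ x y x′ y′ → (x - y) * (x′ - y′) ≈ (x * x′ + y * y′) - (x * y′ + y * x′)
    difference-* x y x′ y′ = begin
      (x - y) * (x′ - y′)                    ≈⟨ x[y-z]≈xy-xz _ _ _ ⟩
      (x - y) * x′ - (x - y) * y′            ≈⟨ +-cong ([y-z]x≈yx-zx _ _ _) (-‿cong ([y-z]x≈yx-zx _ _ _)) ⟩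
      (x * x′ - y * x′) - (x * y′ - y * y′)  ≈⟨ +-congˡ (⁻¹-anti-homo‿- _ _) ⟩
      (x * x′ - y * x′) + (y * y′ - x * y′)  ≈⟨ difference-+ _ _ _ _ ⟩
      (x * x′ + y * y′) - (y * x′ + x * y′)  ≈⟨ +-congˡ (-‿cong (+-comm _ _)) ⟩
      (x * x′ + y * y′) - (x * y′ + y * x′)  ∎

    ι-+* : ∀ p q r s → ι (p ℕ.* q ℕ.+ r ℕ.* s) ≈ ι p * ι q + ι r * ι s
    ι-+* p q r s = trans (×-homo-+ 1# (p ℕ.* q) (r ℕ.* s)) (+-cong (×1-homo-* p q) (×1-homo-* r s))

    ⟦⟧-+ : ∀ x y → ⟦ x +ℤ y ⟧ ≈ ⟦ x ⟧ + ⟦ y ⟧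
    ⟦⟧-+ (a , b) (a′ , b′) = begin
      ⟦ normalise (a ℕ.+ a′) (b ℕ.+ b′) ⟧  ≈⟨ ⟦normalise⟧-difference (a ℕ.+ a′) (b ℕ.+ b′) ⟩
      ι (a ℕ.+ a′) - ι (b ℕ.+ b′)          ≈⟨ +-cong (×-homo-+ 1# a a′) (-‿cong (×-homo-+ 1# b b′)) ⟩
      (ι a + ι a′) - (ι b + ι b′)          ≈⟨ difference-+ _ _ _ _ ⟨
      (ι a - ι b) + (ι a′ - ι b′)          ≈⟨ +-cong (⟦⟧-difference a b) (⟦⟧-difference a′ b′) ⟨
      ⟦ a , b ⟧ + ⟦ a′ , b′ ⟧               ∎

    ⟦⟧-* : ∀ x y → ⟦ x *ℤ y ⟧ ≈ ⟦ x ⟧ * ⟦ y ⟧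
    ⟦⟧-* (a , b) (a′ , b′) = begin
      ⟦ normalise P N ⟧                                      ≈⟨ ⟦normalise⟧-difference P N ⟩
      ι P - ι N                                              ≈⟨ +-cong (ι-+* a a′ b b′) (-‿cong (ι-+* a b′ b a′)) ⟩
      (ι a * ι a′ + ι b * ι b′) - (ι a * ι b′ + ι b * ι a′)  ≈⟨ difference-* _ _ _ _ ⟨
      (ι a - ι b) * (ι a′ - ι b′)                            ≈⟨ *-cong (⟦⟧-difference a b) (⟦⟧-difference a′ b′) ⟨
      ⟦ a , b ⟧ * ⟦ a′ , b′ ⟧                                 ∎
      where
      P N : ℕ
      P = a ℕ.* a′ ℕ.+ b ℕ.* b′
      N = a ℕ.* b′ ℕ.+ b ℕ.* a′

    ⟦⟧-neg : ∀ x → ⟦ -ℤ x ⟧ ≈ - ⟦ x ⟧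
    ⟦⟧-neg (a , b) = begin
      ⟦ b , a ⟧        ≈⟨ ⟦⟧-difference b a ⟩
      ι b - ι a        ≈⟨ ⁻¹-anti-homo‿- _ _ ⟨
      - (ι a - ι b)    ≈⟨ -‿cong (⟦⟧-difference a b) ⟨
      - ⟦ a , b ⟧      ∎

    homomorphism : ℤ-rawRing -Raw-AlmostCommutative⟶ fromCommutativeRing R
    homomorphism = record
      { ⟦_⟧ = ⟦_⟧ ; +-homo = ⟦⟧-+ ; *-homo = ⟦⟧-* ; -‿homo = ⟦⟧-neg ; 0-homo = refl ; 1-homo = refl }

    _≟ℤ_ : ∀ x y → Maybe (⟦ x ⟧ ≈ ⟦ y ⟧)
    x ≟ℤ y with ≡-dec ℕ._≟_ ℕ._≟_ x y
    ... | yes ≡.refl = just refl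
    ... | no _ = nothing

  open import Algebra.Solver.Ring ℤ-rawRing (fromCommutativeRing R) homomorphism _≟ℤ_ public

  :0 :1 :-1 : ∀ {m} → Polynomial m
  :0 = con (0 , 0)
  :1 = con (1 , 0)
  :-1 = con (0 , 1)

module _ {c ℓ} (R : CommutativeRing c ℓ) (inv : ℕ → CommutativeRing.Carrier R) where
  open CommutativeRing R
  open Ops R inv
  open IntegerCoefficientSolver R using (solve; _:=_; _:+_; _:*_; _:-_; :0; :1; :-1)
  open import Algebra.Properties.CommutativeSemigroup +-commutativeSemigroup
    using () renaming (interchange to +-interchange)
  open import Algebra.Properties.CommutativeSemigroup *-commutativeSemigroup
    using (x∙yz≈y∙xz) renaming (interchange to *-interchange)
  open import Relation.Binary.Reasoning.Setoid setoid

  sumLt-cong-< : ∀ m {f g : ℕ → Carrier} → (∀ i → i < m → f i ≈ g i) → sumLt m f ≈ sumLt m g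
  sumLt-cong-< zero eq = refl
  sumLt-cong-< (suc m) eq = +-cong (sumLt-cong-< m (λ i i<m → eq i (ℕ.m<n⇒m<1+n i<m))) (eq m ℕ.≤-refl)

  sumLt-cong : ∀ m {f g : ℕ → Carrier} → (∀ i → f i ≈ g i) → sumLt m f ≈ sumLt m g
  sumLt-cong m eq = sumLt-cong-< m (λ i _ → eq i)

  sumTo-cong-≤ : ∀ n {f g : ℕ → Carrier} → (∀ i → i ≤ n → f i ≈ g i) → sumTo n f ≈ sumTo n g
  sumTo-cong-≤ n eq = sumLt-cong-< (suc n) (λ i i<1+n → eq i (ℕ.≤-pred i<1+n))

  sumLt-zero : ∀ m {f : ℕ → Carrier} → (∀ i → i < m → f i ≈ 0#) → sumLt m f ≈ 0#
  sumLt-zero zero eq = refl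
  sumLt-zero (suc m) eq =
    trans (+-cong (sumLt-zero m (λ i i<m → eq i (ℕ.m<n⇒m<1+n i<m))) (eq m ℕ.≤-refl)) (+-identityˡ 0#)

  sumLt-+ : ∀ m (f g : ℕ → Carrier) → sumLt m (λ i → f i + g i) ≈ sumLt m f + sumLt m g
  sumLt-+ zero f g = sym (+-identityˡ 0#)
  sumLt-+ (suc m) f g = trans (+-congʳ (sumLt-+ m f g)) (+-interchange _ _ _ _)

  sumLt-distribˡ : ∀ m a (f : ℕ → Carrier) → a * sumLt m f ≈ sumLt m (λ i → a * f i)
  sumLt-distribˡ zero a f = zeroʳ a
  sumLt-distribˡ (suc m) a f = trans (distribˡ _ _ _) (+-congʳ (sumLt-distribˡ m a f))

  sumLt-distribʳ : ∀ m a (f : ℕ → Carrier) → sumLt m f * a ≈ sumLt m (λ i → f i * a)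
  sumLt-distribʳ m a f = trans (*-comm _ _) (trans (sumLt-distribˡ m a f) (sumLt-cong m (λ i → *-comm _ _)))

  sumLt-swap : ∀ m k (F : ℕ → ℕ → Carrier) →
    sumLt m (λ i → sumLt k (F i)) ≈ sumLt k (λ j → sumLt m (λ i → F i j))
  sumLt-swap zero k F = sym (sumLt-zero k (λ _ _ → refl))
  sumLt-swap (suc m) k F = trans (+-congʳ (sumLt-swap m k F)) (sym (sumLt-+ k _ _))

  sumLt-distribˡ-weighted : ∀ m c (a f : ℕ → Carrier) →
    c * sumLt m (λ i → a i * f i) ≈ sumLt m (λ i → a i * (c * f i))
  sumLt-distribˡ-weighted m c a f = trans (sumLt-distribˡ m c _) (sumLt-cong m (λ i → x∙yz≈y∙xz _ _ _))

  sumLt-exchange : ∀ m k (a b : ℕ → Carrier) (F : ℕ → ℕ → Carrier) →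
    sumLt m (λ i → a i * sumLt k (λ j → b j * F i j))
      ≈ sumLt k (λ j → b j * sumLt m (λ i → a i * F i j))
  sumLt-exchange m k a b F = begin
    sumLt m (λ i → a i * sumLt k (λ j → b j * F i j))
      ≈⟨ sumLt-cong m (λ i → sumLt-distribˡ k (a i) _) ⟩
    sumLt m (λ i → sumLt k (λ j → a i * (b j * F i j)))
      ≈⟨ sumLt-swap m k _ ⟩
    sumLt k (λ j → sumLt m (λ i → a i * (b j * F i j)))
      ≈⟨ sumLt-cong k (λ j → sym (sumLt-distribˡ-weighted m (b j) a (λ i → F i j))) ⟩
    sumLt k (λ j → b j * sumLt m (λ i → a i * F i j)) ∎

  sumLt-reassoc : ∀ m k (a e : ℕ → Carrier) (F : ℕ → ℕ → Carrier) →
    sumLt k (λ j → sumLt m (λ i → a i * F i j) * e j)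
      ≈ sumLt m (λ i → a i * sumLt k (λ j → F i j * e j))
  sumLt-reassoc m k a e F = begin
    sumLt k (λ j → sumLt m (λ i → a i * F i j) * e j)
      ≈⟨ sumLt-cong k (λ j → *-comm _ _) ⟩
    sumLt k (λ j → e j * sumLt m (λ i → a i * F i j))
      ≈⟨ sumLt-exchange m k a e F ⟨
    sumLt m (λ i → a i * sumLt k (λ j → e j * F i j))
      ≈⟨ sumLt-cong m (λ i → *-congˡ (sumLt-cong k (λ j → *-comm _ _))) ⟩
    sumLt m (λ i → a i * sumLt k (λ j → F i j * e j)) ∎

  sumLt-head : ∀ m (f : ℕ → Carrier) → sumLt (suc m) f ≈ f 0 + sumLt m (λ i → f (suc i))
  sumLt-head zero f = +-comm _ _
  sumLt-head (suc m) f = trans (+-congʳ (sumLt-head m f)) (+-assoc _ _ _)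

  sumLt-split : ∀ a b (f : ℕ → Carrier) → sumLt (a ℕ.+ b) f ≈ sumLt a f + sumLt b (λ j → f (a ℕ.+ j))
  sumLt-split a zero f rewrite ℕ.+-identityʳ a = sym (+-identityʳ _)
  sumLt-split a (suc b) f rewrite ℕ.+-suc a b = trans (+-congʳ (sumLt-split a b f)) (+-assoc _ _ _)

  sumTo-reverse : ∀ n (f : ℕ → Carrier) → sumTo n f ≈ sumTo n (λ i → f (n ∸ i))
  sumTo-reverse zero f = refl
  sumTo-reverse (suc n) f =
    trans (+-congʳ (sumTo-reverse n f)) (trans (+-comm _ _) (sym (sumLt-head (suc n) (λ i → f (suc n ∸ i)))))

  sumTo-antidiagonal : ∀ N (F : ℕ → ℕ → Carrier) →
    sumTo N (λ k → sumTo k (λ i → F i (k ∸ i))) ≈ sumTo N (λ i → sumTo (N ∸ i) (F i))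
  sumTo-antidiagonal zero F = refl
  sumTo-antidiagonal (suc N) F = begin
    sumTo N (λ k → sumTo k (λ i → F i (k ∸ i))) + sumTo (suc N) (λ i → F i (suc N ∸ i))
      ≈⟨ +-congʳ (sumTo-antidiagonal N F) ⟩
    sumTo N rows + (sumTo N (λ i → F i (suc N ∸ i)) + F (suc N) (N ∸ N))
      ≈⟨ +-assoc _ _ _ ⟨
    (sumTo N rows + sumTo N (λ i → F i (suc N ∸ i))) + F (suc N) (N ∸ N)
      ≈⟨ +-cong (sym (sumLt-+ (suc N) _ _)) (sym (+-identityˡ _)) ⟩
    sumTo N (λ i → rows i + F i (suc N ∸ i)) + (0# + F (suc N) (N ∸ N))
      ≈⟨ +-cong (sumTo-cong-≤ N extend-row) last-row ⟩
    sumTo N (λ i → sumTo (suc N ∸ i) (F i)) + sumTo (N ∸ N) (F (suc N)) ∎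
    where
    rows : ℕ → Carrier
    rows i = sumTo (N ∸ i) (F i)
    extend-row : ∀ i → i ≤ N → rows i + F i (suc N ∸ i) ≈ sumTo (suc N ∸ i) (F i)
    extend-row i i≤N rewrite ℕ.+-∸-assoc 1 i≤N = refl
    last-row : 0# + F (suc N) (N ∸ N) ≈ sumTo (N ∸ N) (F (suc N))
    last-row rewrite ℕ.n∸n≡0 N = refl

  natR-+ : ∀ a b → natR (a ℕ.+ b) ≈ natR a + natR b
  natR-+ zero b = sym (+-identityˡ _)
  natR-+ (suc a) b = trans (+-congˡ (natR-+ a b)) (sym (+-assoc _ _ _))

  natR-pascal : ∀ m s → natR (suc m C suc s) ≈ natR (m C s) + natR (m C suc s)
  natR-pascal m s =
    trans (reflexive (≡.cong natR (≡.sym (nCk+nC[k+1]≡[n+1]C[k+1] m s)))) (natR-+ (m C s) (m C suc s))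

  eval : ℕ → Poly → Carrier → Carrier
  eval N p y = sumTo N (λ q → p q * pow y q)

  DegreeAtMost : ℕ → Poly → Set ℓ
  DegreeAtMost N p = ∀ i → N < i → p i ≈ 0#

  pow-+ : ∀ y i j → pow y (i ℕ.+ j) ≈ pow y i * pow y j
  pow-+ y zero j = sym (*-identityˡ _)
  pow-+ y (suc i) j = trans (*-congˡ (pow-+ y i j)) (sym (*-assoc _ _ _))

  eval-extend : ∀ {N p} y → DegreeAtMost N p → ∀ M → N ≤ M → eval M p y ≈ eval N p y
  eval-extend y deg zero z≤n = refl
  eval-extend {N} y deg (suc M) N≤1+M with ℕ.m≤n⇒m<n∨m≡n N≤1+M
  ... | inj₂ ≡.refl = refl
  ... | inj₁ N<1+M = begin
    eval M _ y + _ * pow y (suc M)  ≈⟨ +-cong (eval-extend y deg M (ℕ.≤-pred N<1+M)) (*-congʳ (deg (suc M) N<1+M)) ⟩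
    eval N _ y + 0# * pow y (suc M) ≈⟨ +-congˡ (zeroˡ _) ⟩
    eval N _ y + 0#                 ≈⟨ +-identityʳ _ ⟩
    eval N _ y                      ∎

  DegreeAtMost-⊗ : ∀ {A B p q} → DegreeAtMost A p → DegreeAtMost B q → DegreeAtMost (A ℕ.+ B) (p ⊗ q)
  DegreeAtMost-⊗ {A} {B} {p} {q} deg-p deg-q k A+B<k = sumLt-zero (suc k) term-zero
    where
    term-zero : ∀ i → i < suc k → p i * q (k ∸ i) ≈ 0#
    term-zero i _ with i ℕ.≤? A
    ... | no i≰A = trans (*-congʳ (deg-p i (ℕ.≰⇒> i≰A))) (zeroˡ _)
    ... | yes i≤A = trans (*-congˡ (deg-q (k ∸ i) B<k∸i)) (zeroʳ _)
      where
      B<k∸i : B < k ∸ i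
      B<k∸i = ℕ.m+n≤o⇒m≤o∸n (suc B) (ℕ.≤-trans (ℕ.+-monoʳ-≤ (suc B) i≤A)
                (≡.subst (λ z → suc z ≤ k) (ℕ.+-comm A B) A+B<k))

  eval-⊗ : ∀ {A B p q} y → DegreeAtMost A p → DegreeAtMost B q →
           eval (A ℕ.+ B) (p ⊗ q) y ≈ eval A p y * eval B q y
  eval-⊗ {A} {B} {p} {q} y deg-p deg-q = begin
    sumTo N (λ k → sumTo k (λ i → p i * q (k ∸ i)) * pow y k)
      ≈⟨ sumLt-cong (suc N) (λ k → trans (sumLt-distribʳ (suc k) _ _) (sumTo-cong-≤ k (split-power k))) ⟩
    sumTo N (λ k → sumTo k (λ i → F i (k ∸ i)))
      ≈⟨ sumTo-antidiagonal N F ⟩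
    sumTo N (λ i → sumTo (N ∸ i) (F i))
      ≈⟨ sumLt-cong (suc N) (λ i → sym (sumLt-distribˡ (suc (N ∸ i)) _ _)) ⟩
    sumTo N (λ i → (p i * pow y i) * eval (N ∸ i) q y)
      ≈⟨ sumTo-cong-≤ N truncate ⟩
    sumTo N (λ i → (p i * pow y i) * eval B q y)
      ≈⟨ sumLt-distribʳ (suc N) _ _ ⟨
    eval N p y * eval B q y
      ≈⟨ *-congʳ (eval-extend y deg-p N (ℕ.m≤m+n A B)) ⟩
    eval A p y * eval B q y ∎
    where
    N : ℕ
    N = A ℕ.+ B
    F : ℕ → ℕ → Carrier
    F i j = (p i * pow y i) * (q j * pow y j)
    split-power : ∀ k i → i ≤ k → p i * q (k ∸ i) * pow y k ≈ F i (k ∸ i)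
    split-power k i i≤k = begin
      p i * q (k ∸ i) * pow y k                  ≡⟨ ≡.cong (λ e → p i * q (k ∸ i) * pow y e) (≡.sym (ℕ.m+[n∸m]≡n i≤k)) ⟩
      p i * q (k ∸ i) * pow y (i ℕ.+ (k ∸ i))    ≈⟨ *-congˡ (pow-+ y i (k ∸ i)) ⟩
      p i * q (k ∸ i) * (pow y i * pow y (k ∸ i)) ≈⟨ *-interchange _ _ _ _ ⟩
      F i (k ∸ i)                                ∎
    truncate : ∀ i → i ≤ N → (p i * pow y i) * eval (N ∸ i) q y ≈ (p i * pow y i) * eval B q y
    truncate i i≤N with i ℕ.≤? A
    ... | yes i≤A = *-congˡ (eval-extend y deg-q (N ∸ i)
          (ℕ.m+n≤o⇒m≤o∸n B (≡.subst (λ z → B ℕ.+ i ≤ z) (ℕ.+-comm B A) (ℕ.+-monoʳ-≤ B i≤A))))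
    ... | no i≰A = trans (vanish _) (sym (vanish _))
      where
      vanish : ∀ e → (p i * pow y i) * e ≈ 0#
      vanish e = trans (*-congʳ (trans (*-congʳ (deg-p i (ℕ.≰⇒> i≰A))) (zeroˡ _))) (zeroˡ e)

  eval-sumP : ∀ N M (a : ℕ → Carrier) (P : ℕ → Poly) y →
    eval N (sumP M (λ r → scale (a r) (P r))) y ≈ sumTo M (λ r → a r * eval N (P r) y)
  eval-sumP N M a P y = sumLt-reassoc (suc M) (suc N) a (pow y) P

  DegreeAtMost-const : ∀ a → DegreeAtMost 0 (constP a)
  DegreeAtMost-const a (suc i) _ = refl

  DegreeAtMost-linear : ∀ a → DegreeAtMost 1 (X ⊕ constP a)
  DegreeAtMost-linear a (suc zero) (s≤s ())
  DegreeAtMost-linear a (suc (suc i)) _ = +-identityˡ _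

  eval-const : ∀ a y → eval 0 (constP a) y ≈ a
  eval-const a y = trans (+-identityˡ _) (*-identityʳ _)

  eval-linear : ∀ a y → eval 1 (X ⊕ constP a) y ≈ y + a
  eval-linear a y =
    solve 2 (λ y a → (:0 :+ (:0 :+ a) :* :1) :+ (:1 :+ :0) :* (y :* :1) := y :+ a) refl y a

  DegreeAtMost-⊗-linear : ∀ {A p} a → DegreeAtMost A p → DegreeAtMost (suc A) (p ⊗ (X ⊕ constP a))
  DegreeAtMost-⊗-linear {A} {p} a deg =
    ≡.subst (λ N → DegreeAtMost N (p ⊗ (X ⊕ constP a))) (ℕ.+-comm A 1) (DegreeAtMost-⊗ deg (DegreeAtMost-linear a))

  eval-⊗-linear : ∀ {A p} a y → DegreeAtMost A p →
                  eval (suc A) (p ⊗ (X ⊕ constP a)) y ≈ eval A p y * (y + a)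
  eval-⊗-linear {A} {p} a y deg = begin
    eval (suc A) (p ⊗ (X ⊕ constP a)) y    ≡⟨ ≡.cong (λ N → eval N (p ⊗ (X ⊕ constP a)) y) (ℕ.+-comm 1 A) ⟩
    eval (A ℕ.+ 1) (p ⊗ (X ⊕ constP a)) y  ≈⟨ eval-⊗ y deg (DegreeAtMost-linear a) ⟩
    eval A p y * eval 1 (X ⊕ constP a) y   ≈⟨ *-congˡ (eval-linear a y) ⟩
    eval A p y * (y + a)                    ∎

  DegreeAtMost-powP-linear : ∀ a r → DegreeAtMost r (powP (X ⊕ constP a) r)
  DegreeAtMost-powP-linear a zero = DegreeAtMost-const 1#
  DegreeAtMost-powP-linear a (suc r) = DegreeAtMost-⊗ (DegreeAtMost-linear a) (DegreeAtMost-powP-linear a r)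

  eval-powP-linear : ∀ a r y → eval r (powP (X ⊕ constP a) r) y ≈ pow (y + a) r
  eval-powP-linear a zero y = eval-const 1# y
  eval-powP-linear a (suc r) y =
    trans (eval-⊗ y (DegreeAtMost-linear a) (DegreeAtMost-powP-linear a r))
          (*-cong (eval-linear a y) (eval-powP-linear a r y))

  DegreeAtMost-fallP : ∀ p → DegreeAtMost p (fallP p)
  DegreeAtMost-fallP zero = DegreeAtMost-const 1#
  DegreeAtMost-fallP (suc p) = DegreeAtMost-⊗-linear (- natR p) (DegreeAtMost-fallP p)

  eval-fallP : ∀ p y → eval p (fallP p) y ≈ fallR y p
  eval-fallP zero y = eval-const 1# y
  eval-fallP (suc p) y =
    trans (eval-⊗-linear (- natR p) y (DegreeAtMost-fallP p)) (*-congʳ (eval-fallP p y))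

  riseR : Carrier → ℕ → Carrier
  riseR y zero = 1#
  riseR y (suc k) = riseR y k * (y + natR (suc k))

  DegreeAtMost-riseP1 : ∀ k → DegreeAtMost k (riseP1 k)
  DegreeAtMost-riseP1 zero = DegreeAtMost-const 1#
  DegreeAtMost-riseP1 (suc k) = DegreeAtMost-⊗-linear (natR (suc k)) (DegreeAtMost-riseP1 k)

  eval-riseP1 : ∀ k y → eval k (riseP1 k) y ≈ riseR y k
  eval-riseP1 zero y = eval-const 1# y
  eval-riseP1 (suc k) y =
    trans (eval-⊗-linear (natR (suc k)) y (DegreeAtMost-riseP1 k)) (*-congʳ (eval-riseP1 k y))

  shift : ℕ → Poly → Poly
  shift zero p k = p k
  shift (suc i) p zero = 0#
  shift (suc i) p (suc k) = shift i p k

  shift-cong : ∀ {p q} → (∀ k → p k ≈ q k) → ∀ i k → shift i p k ≈ shift i q k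
  shift-cong eq zero k = eq k
  shift-cong eq (suc i) zero = refl
  shift-cong eq (suc i) (suc k) = shift-cong eq i k

  ⊗-linear-suc : ∀ L p → (∀ j → L (suc (suc j)) ≈ 0#) → ∀ k →
                 (L ⊗ p) (suc k) ≈ L 0 * p (suc k) + L 1 * p k
  ⊗-linear-suc L p L≈0 k = begin
    sumLt (suc (suc k)) term                           ≈⟨ sumLt-head (suc k) term ⟩
    term 0 + sumLt (suc k) (λ i → term (suc i))        ≈⟨ +-congˡ (sumLt-head k (λ i → term (suc i))) ⟩
    term 0 + (term 1 + sumLt k (λ i → term (suc (suc i))))
      ≈⟨ +-congˡ (+-congˡ (sumLt-zero k (λ i _ → trans (*-congʳ (L≈0 i)) (zeroˡ _)))) ⟩
    term 0 + (term 1 + 0#)                             ≈⟨ +-congˡ (+-identityʳ _) ⟩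
    L 0 * p (suc k) + L 1 * p k                        ∎
    where
    term : ℕ → Carrier
    term i = L i * p (suc k ∸ i)

  ⊗-divisible-by-X : ∀ D D′ p → D 0 ≈ 0# → (∀ j → D (suc j) ≈ D′ j) → ∀ k →
                     (D ⊗ p) (suc k) ≈ (D′ ⊗ p) k
  ⊗-divisible-by-X D D′ p D0≈0 D≈D′ k = begin
    sumLt (suc (suc k)) term                   ≈⟨ sumLt-head (suc k) term ⟩
    term 0 + sumLt (suc k) (λ i → term (suc i))
      ≈⟨ +-cong (trans (*-congʳ D0≈0) (zeroˡ _)) (sumLt-cong (suc k) (λ i → *-congʳ (D≈D′ i))) ⟩
    0# + (D′ ⊗ p) k                            ≈⟨ +-identityˡ _ ⟩
    (D′ ⊗ p) k                                 ∎
    where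
    term : ℕ → Carrier
    term i = D i * p (suc k ∸ i)

  powP-X-⊗ : ∀ i p k → (powP X i ⊗ p) k ≈ shift i p k
  powP-X-⊗ zero p zero = trans (+-identityˡ _) (*-identityˡ _)
  powP-X-⊗ zero p (suc k) =
    trans (⊗-linear-suc (constP 1#) p (λ _ → refl) k) (trans (+-cong (*-identityˡ _) (zeroˡ _)) (+-identityʳ _))
  powP-X-⊗ (suc i) p zero =
    trans (+-identityˡ _) (trans (*-congʳ (trans (+-identityˡ _) (zeroˡ _))) (zeroˡ _))
  powP-X-⊗ (suc i) p (suc k) = trans (⊗-divisible-by-X (X ⊗ powP X i) (powP X i) p X⊗-0 X⊗-suc k) (powP-X-⊗ i p k)
    where
    X⊗-0 : (X ⊗ powP X i) 0 ≈ 0#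
    X⊗-0 = trans (+-identityˡ _) (zeroˡ _)
    X⊗-suc : ∀ j → (X ⊗ powP X i) (suc j) ≈ powP X i j
    X⊗-suc j = trans (⊗-linear-suc X (powP X i) (λ _ → refl) j) (trans (+-cong (zeroˡ _) (*-identityˡ _)) (+-identityˡ _))

  onePlusX oneMinusX : Poly
  onePlusX = constP 1# ⊕ X
  oneMinusX = constP 1# ⊕ scale (- 1#) X

  -- VinvMono n s k is the coefficient of x^k in V_n^{-1} x^s = x^s (1-x)^(n-s).
  VinvMono : ℕ → ℕ → ℕ → Carrier
  VinvMono n zero k = pow (- 1#) k * natR (n C k)
  VinvMono n (suc s) zero = 0#
  VinvMono n (suc s) (suc k) = VinvMono (pred n) s k

  powP-onePlusX : ∀ m s → powP onePlusX m s ≈ natR (m C s)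
  powP-onePlusX zero zero = sym (+-identityʳ _)
  powP-onePlusX zero (suc s) = refl
  powP-onePlusX (suc m) zero =
    trans (+-identityˡ _) (trans (*-cong (+-identityʳ _) (powP-onePlusX m 0)) (*-identityˡ _))
  powP-onePlusX (suc m) (suc s) = begin
    (onePlusX ⊗ powP onePlusX m) (suc s)
      ≈⟨ ⊗-linear-suc onePlusX (powP onePlusX m) (λ _ → +-identityʳ _) s ⟩
    (1# + 0#) * powP onePlusX m (suc s) + (0# + 1#) * powP onePlusX m s
      ≈⟨ +-cong (*-cong (+-identityʳ _) (powP-onePlusX m (suc s))) (*-cong (+-identityˡ _) (powP-onePlusX m s)) ⟩
    1# * natR (m C suc s) + 1# * natR (m C s)
      ≈⟨ +-cong (*-identityˡ _) (*-identityˡ _) ⟩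
    natR (m C suc s) + natR (m C s)
      ≈⟨ +-comm _ _ ⟩
    natR (m C s) + natR (m C suc s)
      ≈⟨ natR-pascal m s ⟨
    natR (suc m C suc s) ∎

  powP-oneMinusX : ∀ m s → powP oneMinusX m s ≈ VinvMono m 0 s
  powP-oneMinusX zero zero = sym (trans (*-identityˡ _) (+-identityʳ _))
  powP-oneMinusX zero (suc s) = sym (zeroʳ _)
  powP-oneMinusX (suc m) zero =
    trans (+-identityˡ _) (trans (*-cong (trans (+-congˡ (zeroʳ _)) (+-identityʳ _)) (powP-oneMinusX m 0)) (*-identityˡ _))
  powP-oneMinusX (suc m) (suc s) = begin
    (oneMinusX ⊗ powP oneMinusX m) (suc s)
      ≈⟨ ⊗-linear-suc oneMinusX (powP oneMinusX m) (λ _ → trans (+-identityˡ _) (zeroʳ _)) s ⟩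
    (1# + - 1# * 0#) * powP oneMinusX m (suc s) + (0# + - 1# * 1#) * powP oneMinusX m s
      ≈⟨ +-cong (*-congˡ (powP-oneMinusX m (suc s))) (*-congˡ (powP-oneMinusX m s)) ⟩
    (1# + - 1# * 0#) * (sign * natR (m C suc s)) + (0# + - 1# * 1#) * (pow (- 1#) s * natR (m C s))
      ≈⟨ solve 3 (λ p a b → (:1 :+ :-1 :* :0) :* ((:-1 :* p) :* b) :+ (:0 :+ :-1 :* :1) :* (p :* a)
                            := (:-1 :* p) :* (a :+ b)) refl (pow (- 1#) s) _ _ ⟩
    sign * (natR (m C s) + natR (m C suc s))
      ≈⟨ *-congˡ (natR-pascal m s) ⟨
    sign * natR (suc m C suc s) ∎
    where
    sign : Carrier
    sign = pow (- 1#) (suc s)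

  shift-C : ∀ q m r → r ≤ q ℕ.+ m → shift q (λ s → natR (m C s)) r ≈ natR (m C (q ℕ.+ m ∸ r))
  shift-C zero m r r≤m = reflexive (≡.cong natR (nCk≡nC[n∸k] r≤m))
  shift-C (suc q) m zero _ = reflexive (≡.cong natR (≡.sym (k>n⇒nCk≡0 (s≤s (ℕ.m≤n+m m q)))))
  shift-C (suc q) m (suc r) (s≤s r≤q+m) = shift-C q m r r≤q+m

  shift-VinvMono : ∀ i m k → shift i (VinvMono m 0) k ≡ VinvMono (i ℕ.+ m) i k
  shift-VinvMono zero m k = ≡.refl
  shift-VinvMono (suc i) m zero = ≡.refl
  shift-VinvMono (suc i) m (suc k) = shift-VinvMono i m k

  V-coeff : ∀ n f r → r ≤ n → V n f r ≈ sumTo n (λ q → f q * natR ((n ∸ q) C (n ∸ r)))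
  V-coeff n f r r≤n = sumTo-cong-≤ n (λ q q≤n → *-congˡ (basis-coeff q q≤n))
    where
    basis-coeff : ∀ q → q ≤ n → (powP X q ⊗ powP onePlusX (n ∸ q)) r ≈ natR ((n ∸ q) C (n ∸ r))
    basis-coeff q q≤n = begin
      (powP X q ⊗ powP onePlusX (n ∸ q)) r          ≈⟨ powP-X-⊗ q _ r ⟩
      shift q (powP onePlusX (n ∸ q)) r             ≈⟨ shift-cong (powP-onePlusX (n ∸ q)) q r ⟩
      shift q (λ s → natR ((n ∸ q) C s)) r          ≈⟨ shift-C q (n ∸ q) r (≡.subst (r ≤_) (≡.sym q+[n∸q]≡n) r≤n) ⟩
      natR ((n ∸ q) C (q ℕ.+ (n ∸ q) ∸ r))          ≡⟨ ≡.cong (λ e → natR ((n ∸ q) C (e ∸ r))) q+[n∸q]≡n ⟩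
      natR ((n ∸ q) C (n ∸ r))                      ∎
      where
      q+[n∸q]≡n : q ℕ.+ (n ∸ q) ≡ n
      q+[n∸q]≡n = ℕ.m+[n∸m]≡n q≤n

  Vinv-coeff : ∀ n c k → Vinv n c k ≈ sumTo n (λ i → c i * VinvMono n i k)
  Vinv-coeff n c k = sumTo-cong-≤ n (λ i i≤n → *-congˡ (basis-coeff i i≤n))
    where
    basis-coeff : ∀ i → i ≤ n → (powP X i ⊗ powP oneMinusX (n ∸ i)) k ≈ VinvMono n i k
    basis-coeff i i≤n = begin
      (powP X i ⊗ powP oneMinusX (n ∸ i)) k     ≈⟨ powP-X-⊗ i _ k ⟩
      shift i (powP oneMinusX (n ∸ i)) k        ≈⟨ shift-cong (powP-oneMinusX (n ∸ i)) i k ⟩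
      shift i (VinvMono (n ∸ i) 0) k            ≡⟨ shift-VinvMono i (n ∸ i) k ⟩
      VinvMono (i ℕ.+ (n ∸ i)) i k              ≡⟨ ≡.cong (λ e → VinvMono e i k) (ℕ.m+[n∸m]≡n i≤n) ⟩
      VinvMono n i k                            ∎

  Bmono-< : ∀ γ {p i} → p < i → Bmono γ p i ≈ 0#
  Bmono-< γ {p} {i} p<i with i ℕ.≤ᵇ p | ℕ.≤ᵇ⇒≤ i p
  ... | false | _ = refl
  ... | true | i≤p = ⊥-elim (ℕ.<⇒≱ p<i (i≤p _))

  Bmono-+ : ∀ γ i l → Bmono γ (i ℕ.+ l) i ≈ binom γ l
  Bmono-+ γ i l with i ℕ.≤ᵇ (i ℕ.+ l) | ℕ.≤⇒≤ᵇ (ℕ.m≤m+n i l)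
  ... | true | _ = reflexive (≡.cong (binom γ) (ℕ.m+n∸m≡n i l))

  B-coeff : ∀ n γ c i → i ≤ n → B n γ c i ≈ sumTo (n ∸ i) (λ l → c (i ℕ.+ l) * binom γ l)
  B-coeff n γ c i i≤n = begin
    sumLt (suc n) term                                         ≡⟨ ≡.cong (λ m → sumLt m term) i+[1+n∸i]≡1+n ⟨
    sumLt (i ℕ.+ suc (n ∸ i)) term                             ≈⟨ sumLt-split i (suc (n ∸ i)) term ⟩
    sumLt i term + sumTo (n ∸ i) (λ l → term (i ℕ.+ l))
      ≈⟨ +-cong (sumLt-zero i (λ p p<i → trans (*-congˡ (Bmono-< γ p<i)) (zeroʳ _)))
                (sumLt-cong (suc (n ∸ i)) (λ l → *-congˡ (Bmono-+ γ i l))) ⟩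
    0# + sumTo (n ∸ i) (λ l → c (i ℕ.+ l) * binom γ l)         ≈⟨ +-identityˡ _ ⟩
    sumTo (n ∸ i) (λ l → c (i ℕ.+ l) * binom γ l)              ∎
    where
    term : ℕ → Carrier
    term p = c p * Bmono γ p i
    i+[1+n∸i]≡1+n : i ℕ.+ suc (n ∸ i) ≡ suc n
    i+[1+n∸i]≡1+n = ≡.trans (ℕ.+-suc i (n ∸ i)) (≡.cong suc (ℕ.m+[n∸m]≡n i≤n))

  fallR-cong : ∀ {y y′} → y ≈ y′ → ∀ k → fallR y k ≈ fallR y′ k
  fallR-cong eq zero = refl
  fallR-cong eq (suc k) = *-cong (fallR-cong eq k) (+-congʳ eq)

  binom-cong : ∀ {y y′} → y ≈ y′ → ∀ k → binom y k ≈ binom y′ k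
  binom-cong eq k = *-congʳ (fallR-cong eq k)

  fallR-+ : ∀ y a b → fallR y (a ℕ.+ b) ≈ fallR y a * fallR (y - natR a) b
  fallR-+ y a zero rewrite ℕ.+-identityʳ a = sym (*-identityʳ _)
  fallR-+ y a (suc b) rewrite ℕ.+-suc a b = begin
    fallR y (a ℕ.+ b) * (y - natR (a ℕ.+ b))
      ≈⟨ *-cong (fallR-+ y a b) (+-congˡ (-‿cong (natR-+ a b))) ⟩
    (fallR y a * fallR (y - natR a) b) * (y - (natR a + natR b))
      ≈⟨ solve 5 (λ F G y a b → (F :* G) :* (y :- (a :+ b)) := F :* (G :* ((y :- a) :- b))) refl _ _ _ _ _ ⟩
    fallR y a * (fallR (y - natR a) b * ((y - natR a) - natR b)) ∎

  fallR-rising : ∀ z m → fallR (z + natR m) m ≈ riseR z m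
  fallR-rising z zero = refl
  fallR-rising z (suc m) = begin
    fallR (z + natR (suc m)) (1 ℕ.+ m)
      ≈⟨ fallR-+ (z + natR (suc m)) 1 m ⟩
    fallR (z + natR (suc m)) 1 * fallR ((z + natR (suc m)) - natR 1) m
      ≈⟨ *-congˡ (fallR-cong (solve 2 (λ z t → (z :+ (:1 :+ t)) :- (:1 :+ :0) := z :+ t) refl z (natR m)) m) ⟩
    fallR (z + natR (suc m)) 1 * fallR (z + natR m) m
      ≈⟨ *-congˡ (fallR-rising z m) ⟩
    (1# * ((z + (1# + natR m)) - 0#)) * riseR z m
      ≈⟨ solve 3 (λ z t r → (:1 :* ((z :+ (:1 :+ t)) :- :0)) :* r := r :* (z :+ (:1 :+ t))) refl z (natR m) (riseR z m) ⟩
    riseR z (suc m) ∎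

  fallR-+-rising : ∀ z m p → fallR (z + natR m) (m ℕ.+ p) ≈ riseR z m * fallR z p
  fallR-+-rising z m p = trans (fallR-+ (z + natR m) m p)
    (*-cong (fallR-rising z m) (fallR-cong (solve 2 (λ z t → (z :+ t) :- t := z) refl z (natR m)) p))

  fallR-pascal : ∀ y k → fallR (y + 1#) (suc k) ≈ fallR y (suc k) + natR (suc k) * fallR y k
  fallR-pascal y zero =
    solve 1 (λ y → :1 :* ((y :+ :1) :- :0) := :1 :* (y :- :0) :+ (:1 :+ :0) :* :1) refl y
  fallR-pascal y (suc k) = trans (*-congʳ (fallR-pascal y k))
    (solve 3 (λ F y t → (F :* (y :- t) :+ (:1 :+ t) :* F) :* ((y :+ :1) :- (:1 :+ t))
                        := (F :* (y :- t)) :* (y :- (:1 :+ t)) :+ (:1 :+ (:1 :+ t)) :* (F :* (y :- t)))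
       refl (fallR y k) y (natR k))

  VinvMono-pascal : ∀ n s k → suc s ≤ n → VinvMono n (suc s) (suc k) ≈ VinvMono n s k + VinvMono n (suc s) k
  VinvMono-pascal (suc n) zero zero _ = solve 0 (:1 :* (:1 :+ :0) := (:1 :* (:1 :+ :0)) :+ :0) refl
  VinvMono-pascal (suc n) zero (suc k) _ = begin
    VinvMono n 0 (suc k)
      ≈⟨ solve 3 (λ p a b → (:-1 :* p) :* b := (:-1 :* p) :* (a :+ b) :+ p :* a) refl
           (pow (- 1#) k) (natR (n C k)) (natR (n C suc k)) ⟩
    pow (- 1#) (suc k) * (natR (n C k) + natR (n C suc k)) + VinvMono n 0 k
      ≈⟨ +-congʳ (*-congˡ (natR-pascal n k)) ⟨
    VinvMono (suc n) 0 (suc k) + VinvMono n 0 k ∎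
  VinvMono-pascal (suc n) (suc s) zero _ = sym (+-identityˡ _)
  VinvMono-pascal (suc n) (suc s) (suc k) (s≤s 1+s≤n) = VinvMono-pascal n s k 1+s≤n

  uWeight : ℕ → ℕ → Carrier
  uWeight n j = pow (- 1#) j * natR (suc n C j)

  uWeight-sum : ∀ n k → sumTo k (λ j → uWeight n j * natR ((k ∸ j) C 0)) ≈ VinvMono n 0 k
  uWeight-sum n zero = solve 0 (:0 :+ (:1 :* (:1 :+ :0)) :* (:1 :+ :0) := :1 :* (:1 :+ :0)) refl
  uWeight-sum n (suc k) = begin
    sumTo k (λ j → uWeight n j * natR ((suc k ∸ j) C 0)) + uWeight n (suc k) * natR ((k ∸ k) C 0)
      ≈⟨ +-cong (uWeight-sum n k) (*-congʳ (*-congˡ (natR-pascal n k))) ⟩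
    pow (- 1#) k * natR (n C k) + (pow (- 1#) (suc k) * (natR (n C k) + natR (n C suc k))) * (1# + 0#)
      ≈⟨ solve 3 (λ p a b → p :* a :+ ((:-1 :* p) :* (a :+ b)) :* (:1 :+ :0) := (:-1 :* p) :* b) refl
           (pow (- 1#) k) (natR (n C k)) (natR (n C suc k)) ⟩
    VinvMono n 0 (suc k) ∎

  uWeight-convolution-pascal : ∀ n k s →
    sumTo (suc k) (λ j → uWeight n j * natR ((suc k ∸ j) C suc s))
      ≈ sumTo k (λ j → uWeight n j * natR ((k ∸ j) C s)) + sumTo k (λ j → uWeight n j * natR ((k ∸ j) C suc s))
  uWeight-convolution-pascal n k s =
    trans (+-cong (sumTo-cong-≤ k split) last-vanishes) (trans (+-identityʳ _) (sumLt-+ (suc k) _ _))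
    where
    split : ∀ j → j ≤ k → uWeight n j * natR ((suc k ∸ j) C suc s)
              ≈ uWeight n j * natR ((k ∸ j) C s) + uWeight n j * natR ((k ∸ j) C suc s)
    split j j≤k rewrite ℕ.+-∸-assoc 1 j≤k = trans (*-congˡ (natR-pascal (k ∸ j) s)) (distribˡ _ _ _)
    last-vanishes : uWeight n (suc k) * natR ((k ∸ k) C suc s) ≈ 0#
    last-vanishes rewrite ℕ.n∸n≡0 k = zeroʳ _

  uWeight-convolution : ∀ n s → s ≤ n → ∀ k → sumTo k (λ j → uWeight n j * natR ((k ∸ j) C s)) ≈ VinvMono n s k
  uWeight-convolution n zero _ k = uWeight-sum n k
  uWeight-convolution n (suc s) _ zero = trans (+-identityˡ _) (zeroʳ _)
  uWeight-convolution n (suc s) s<n (suc k) = begin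
    sumTo (suc k) (λ j → uWeight n j * natR ((suc k ∸ j) C suc s))
      ≈⟨ uWeight-convolution-pascal n k s ⟩
    sumTo k (λ j → uWeight n j * natR ((k ∸ j) C s)) + sumTo k (λ j → uWeight n j * natR ((k ∸ j) C suc s))
      ≈⟨ +-cong (uWeight-convolution n s (ℕ.<⇒≤ s<n) k) (uWeight-convolution n (suc s) s<n k) ⟩
    VinvMono n s k + VinvMono n (suc s) k
      ≈⟨ VinvMono-pascal n s k s<n ⟨
    VinvMono n (suc s) (suc k) ∎

  binom-fallR-riseR : ∀ n p z → p ≤ n → invFact n * (fallR z p * riseR z (n ∸ p)) ≈ binom (z + natR (n ∸ p)) n
  binom-fallR-riseR n p z p≤n = begin
    invFact n * (fallR z p * riseR z (n ∸ p))   ≈⟨ *-comm _ _ ⟩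
    (fallR z p * riseR z (n ∸ p)) * invFact n   ≈⟨ *-congʳ (*-comm _ _) ⟩
    (riseR z (n ∸ p) * fallR z p) * invFact n   ≈⟨ *-congʳ (fallR-+-rising z (n ∸ p) p) ⟨
    fallR (z + natR (n ∸ p)) (n ∸ p ℕ.+ p) * invFact n
                                                ≡⟨ ≡.cong (λ e → fallR (z + natR (n ∸ p)) e * invFact n) (ℕ.m∸n+n≡m p≤n) ⟩
    binom (z + natR (n ∸ p)) n                  ∎

  U-values : ∀ n g k → U n g k ≈ invFact n * sumTo k (λ j → uWeight n j * eval n g (natR (k ∸ j)))
  U-values n g k = begin
    sumTo n (λ q → g q * (invFact n * sumTo k (λ j → uWeight n j * pow (natR (k ∸ j)) q)))
      ≈⟨ sumLt-distribˡ-weighted (suc n) (invFact n) g _ ⟨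
    invFact n * sumTo n (λ q → g q * sumTo k (λ j → uWeight n j * pow (natR (k ∸ j)) q))
      ≈⟨ *-congˡ (sumLt-exchange (suc n) (suc k) g (uWeight n) (λ q j → pow (natR (k ∸ j)) q)) ⟩
    invFact n * sumTo k (λ j → uWeight n j * eval n g (natR (k ∸ j))) ∎

  eval-E : ∀ n γ g y → eval n (E n γ g) y ≈ eval n g (y + γ)
  eval-E n γ g y = trans (eval-sumP n n g (powP (X ⊕ constP γ)) y) (sumTo-cong-≤ n (λ q q≤n → *-congˡ (
    trans (eval-extend y (DegreeAtMost-powP-linear γ q) n q≤n) (eval-powP-linear γ q y))))

  eval-Uinv : ∀ n f z → eval n (Uinv n f) z ≈ sumTo n (λ p → f p * (fallR z p * riseR z (n ∸ p)))
  eval-Uinv n f z =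
    trans (eval-sumP n n f (λ p → fallP p ⊗ riseP1 (n ∸ p)) z) (sumTo-cong-≤ n (λ p p≤n → *-congˡ (basis p p≤n)))
    where
    basis : ∀ p → p ≤ n → eval n (fallP p ⊗ riseP1 (n ∸ p)) z ≈ fallR z p * riseR z (n ∸ p)
    basis p p≤n = begin
      eval n (fallP p ⊗ riseP1 (n ∸ p)) z
        ≡⟨ ≡.cong (λ e → eval e (fallP p ⊗ riseP1 (n ∸ p)) z) (ℕ.m+[n∸m]≡n p≤n) ⟨
      eval (p ℕ.+ (n ∸ p)) (fallP p ⊗ riseP1 (n ∸ p)) z
        ≈⟨ eval-⊗ z (DegreeAtMost-fallP p) (DegreeAtMost-riseP1 (n ∸ p)) ⟩
      eval p (fallP p) z * eval (n ∸ p) (riseP1 (n ∸ p)) z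
        ≈⟨ *-cong (eval-fallP p z) (eval-riseP1 (n ∸ p) z) ⟩
      fallR z p * riseR z (n ∸ p) ∎

  module _ (inv-correct : ∀ m → natR (suc m) * inv (suc m) ≈ 1#) where

    binom-pascal : ∀ y k → binom (y + 1#) (suc k) ≈ binom y (suc k) + binom y k
    binom-pascal y k = begin
      fallR (y + 1#) (suc k) * invFact (suc k)
        ≈⟨ *-congʳ (fallR-pascal y k) ⟩
      (fallR y (suc k) + natR (suc k) * fallR y k) * invFact (suc k)
        ≈⟨ solve 4 (λ F t G I → (F :+ t :* G) :* I := F :* I :+ G :* (t :* I)) refl _ _ _ _ ⟩
      binom y (suc k) + fallR y k * (natR (suc k) * invFact (suc k))
        ≈⟨ +-congˡ (*-congˡ (trans (sym (*-assoc _ _ _)) (trans (*-congʳ (inv-correct k)) (*-identityˡ _)))) ⟩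
      binom y (suc k) + binom y k ∎

    binom-vandermonde : ∀ a m K → binom (a + natR m) K ≈ sumTo K (λ l → binom a l * natR (m C (K ∸ l)))
    binom-vandermonde a zero K = sym (begin
      sumLt K term + binom a K * natR (0 C (K ∸ K))
        ≈⟨ +-cong (sumLt-zero K vanish) (*-congˡ (reflexive (≡.cong (λ e → natR (0 C e)) (ℕ.n∸n≡0 K)))) ⟩
      0# + binom a K * (1# + 0#)   ≈⟨ solve 1 (λ b → :0 :+ b :* (:1 :+ :0) := b) refl _ ⟩
      binom a K                    ≈⟨ binom-cong (+-identityʳ a) K ⟨
      binom (a + 0#) K             ∎)
      where
      term : ℕ → Carrier
      term l = binom a l * natR (0 C (K ∸ l))
      vanish : ∀ l → l < K → term l ≈ 0#
      vanish l l<K rewrite k>n⇒nCk≡0 {0} {K ∸ l} (ℕ.m<n⇒0<n∸m l<K) = zeroʳ _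
    binom-vandermonde a (suc m) zero = solve 0 (:1 :* :1 := :0 :+ (:1 :* :1) :* (:1 :+ :0)) refl
    binom-vandermonde a (suc m) (suc K) = begin
      binom (a + natR (suc m)) (suc K)
        ≈⟨ binom-cong (solve 2 (λ a t → a :+ (:1 :+ t) := (a :+ t) :+ :1) refl a (natR m)) (suc K) ⟩
      binom ((a + natR m) + 1#) (suc K)
        ≈⟨ binom-pascal (a + natR m) K ⟩
      binom (a + natR m) (suc K) + binom (a + natR m) K
        ≈⟨ +-cong (binom-vandermonde a m (suc K)) (binom-vandermonde a m K) ⟩
      (sumTo K next + binom a (suc K) * natR (m C (K ∸ K))) + sumTo K same
        ≈⟨ solve 3 (λ G x H → (G :+ x) :+ H := (H :+ G) :+ x) refl (sumTo K next) _ (sumTo K same) ⟩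
      (sumTo K same + sumTo K next) + binom a (suc K) * natR (m C (K ∸ K))
        ≈⟨ +-cong (trans (sym (sumLt-+ (suc K) same next)) (sumTo-cong-≤ K combine)) last-term ⟩
      sumTo (suc K) (λ l → binom a l * natR (suc m C (suc K ∸ l))) ∎
      where
      next same : ℕ → Carrier
      next l = binom a l * natR (m C (suc K ∸ l))
      same l = binom a l * natR (m C (K ∸ l))
      combine : ∀ l → l ≤ K → same l + next l ≈ binom a l * natR (suc m C (suc K ∸ l))
      combine l l≤K rewrite ℕ.+-∸-assoc 1 l≤K = trans (sym (distribˡ _ _ _)) (*-congˡ (sym (natR-pascal m (K ∸ l))))
      last-term : binom a (suc K) * natR (m C (K ∸ K)) ≈ binom a (suc K) * natR (suc m C (K ∸ K))
      last-term rewrite ℕ.n∸n≡0 K = refl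

    uWeight-binom-convolution : ∀ n a k →
      sumTo k (λ j → uWeight n j * binom (natR (k ∸ j) + a) n)
        ≈ sumTo n (λ i → binom a (n ∸ i) * VinvMono n i k)
    uWeight-binom-convolution n a k = begin
      sumTo k (λ j → uWeight n j * binom (natR (k ∸ j) + a) n)
        ≈⟨ sumLt-cong (suc k) (λ j → *-congˡ (trans (binom-cong (+-comm _ _) n) (binom-vandermonde a (k ∸ j) n))) ⟩
      sumTo k (λ j → uWeight n j * sumTo n (λ l → binom a l * natR ((k ∸ j) C (n ∸ l))))
        ≈⟨ sumLt-exchange (suc k) (suc n) (uWeight n) (binom a) (λ j l → natR ((k ∸ j) C (n ∸ l))) ⟩
      sumTo n (λ l → binom a l * sumTo k (λ j → uWeight n j * natR ((k ∸ j) C (n ∸ l))))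
        ≈⟨ sumLt-cong (suc n) (λ l → *-congˡ (uWeight-convolution n (n ∸ l) (ℕ.m∸n≤m n l) k)) ⟩
      sumTo n (λ l → binom a l * VinvMono n (n ∸ l) k)
        ≈⟨ sumTo-reverse n _ ⟩
      sumTo n (λ i → binom a (n ∸ i) * VinvMono n (n ∸ (n ∸ i)) k)
        ≈⟨ sumTo-cong-≤ n (λ i i≤n → reflexive (≡.cong (λ e → binom a (n ∸ i) * VinvMono n e k) (ℕ.m∸[m∸n]≡n i≤n))) ⟩
      sumTo n (λ i → binom a (n ∸ i) * VinvMono n i k) ∎

    U-E-Uinv : ∀ n γ f k → U n (E n γ (Uinv n f)) k
      ≈ sumTo n (λ p → f p * sumTo n (λ i → binom (γ + natR (n ∸ p)) (n ∸ i) * VinvMono n i k))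
    U-E-Uinv n γ f k = begin
      U n (E n γ (Uinv n f)) k
        ≈⟨ U-values n _ k ⟩
      invFact n * sumTo k (λ j → uWeight n j * eval n (E n γ (Uinv n f)) (t j))
        ≈⟨ *-congˡ (sumLt-cong (suc k) (λ j → *-congˡ (trans (eval-E n γ _ (t j)) (eval-Uinv n f (t j + γ))))) ⟩
      invFact n * sumTo k (λ j → uWeight n j * sumTo n (λ p → f p * XR p j))
        ≈⟨ *-congˡ (sumLt-exchange (suc k) (suc n) (uWeight n) f (λ j p → XR p j)) ⟩
      invFact n * sumTo n (λ p → f p * sumTo k (λ j → uWeight n j * XR p j))
        ≈⟨ sumLt-distribˡ-weighted (suc n) (invFact n) f _ ⟩
      sumTo n (λ p → f p * (invFact n * sumTo k (λ j → uWeight n j * XR p j)))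
        ≈⟨ sumTo-cong-≤ n (λ p p≤n → *-congˡ (column p p≤n)) ⟩
      sumTo n (λ p → f p * sumTo n (λ i → binom (γ + natR (n ∸ p)) (n ∸ i) * VinvMono n i k)) ∎
      where
      t : ℕ → Carrier
      t j = natR (k ∸ j)
      XR : ℕ → ℕ → Carrier
      XR p j = fallR (t j + γ) p * riseR (t j + γ) (n ∸ p)
      column : ∀ p → p ≤ n → invFact n * sumTo k (λ j → uWeight n j * XR p j)
                              ≈ sumTo n (λ i → binom (γ + natR (n ∸ p)) (n ∸ i) * VinvMono n i k)
      column p p≤n = begin
        invFact n * sumTo k (λ j → uWeight n j * XR p j)
          ≈⟨ sumLt-distribˡ-weighted (suc k) (invFact n) (uWeight n) _ ⟩
        sumTo k (λ j → uWeight n j * (invFact n * XR p j))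
          ≈⟨ sumLt-cong (suc k) (λ j → *-congˡ (trans (binom-fallR-riseR n p (t j + γ) p≤n)
                                                      (binom-cong (+-assoc _ _ _) n))) ⟩
        sumTo k (λ j → uWeight n j * binom (t j + (γ + natR (n ∸ p))) n)
          ≈⟨ uWeight-binom-convolution n (γ + natR (n ∸ p)) k ⟩
        sumTo n (λ i → binom (γ + natR (n ∸ p)) (n ∸ i) * VinvMono n i k) ∎

    B-V-coeff : ∀ n γ f i → i ≤ n → B n γ (V n f) i ≈ sumTo n (λ q → f q * binom (γ + natR (n ∸ q)) (n ∸ i))
    B-V-coeff n γ f i i≤n = begin
      B n γ (V n f) i
        ≈⟨ B-coeff n γ (V n f) i i≤n ⟩
      sumTo (n ∸ i) (λ l → V n f (i ℕ.+ l) * binom γ l)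
        ≈⟨ sumTo-cong-≤ (n ∸ i) (λ l l≤n∸i → *-congʳ (V-coeff n f (i ℕ.+ l) (i+l≤n l l≤n∸i))) ⟩
      sumTo (n ∸ i) (λ l → sumTo n (λ q → f q * natR ((n ∸ q) C (n ∸ (i ℕ.+ l)))) * binom γ l)
        ≈⟨ sumLt-reassoc (suc n) (suc (n ∸ i)) f (binom γ) (λ q l → natR ((n ∸ q) C (n ∸ (i ℕ.+ l)))) ⟩
      sumTo n (λ q → f q * sumTo (n ∸ i) (λ l → natR ((n ∸ q) C (n ∸ (i ℕ.+ l))) * binom γ l))
        ≈⟨ sumLt-cong (suc n) (λ q → *-congˡ (vandermonde q)) ⟩
      sumTo n (λ q → f q * binom (γ + natR (n ∸ q)) (n ∸ i)) ∎
      where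
      i+l≤n : ∀ l → l ≤ n ∸ i → i ℕ.+ l ≤ n
      i+l≤n l l≤n∸i = ≡.subst (i ℕ.+ l ≤_) (ℕ.m+[n∸m]≡n i≤n) (ℕ.+-monoʳ-≤ i l≤n∸i)
      vandermonde : ∀ q → sumTo (n ∸ i) (λ l → natR ((n ∸ q) C (n ∸ (i ℕ.+ l))) * binom γ l)
                          ≈ binom (γ + natR (n ∸ q)) (n ∸ i)
      vandermonde q = sym (trans (binom-vandermonde γ (n ∸ q) (n ∸ i)) (sumLt-cong (suc (n ∸ i)) (λ l →
        trans (*-comm _ _) (reflexive (≡.cong (λ e → natR ((n ∸ q) C e) * binom γ l) (ℕ.∸-+-assoc n i l))))))

    Vinv-B-V : ∀ n γ f k → Vinv n (B n γ (V n f)) k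
      ≈ sumTo n (λ p → f p * sumTo n (λ i → binom (γ + natR (n ∸ p)) (n ∸ i) * VinvMono n i k))
    Vinv-B-V n γ f k = begin
      Vinv n (B n γ (V n f)) k
        ≈⟨ Vinv-coeff n _ k ⟩
      sumTo n (λ i → B n γ (V n f) i * VinvMono n i k)
        ≈⟨ sumTo-cong-≤ n (λ i i≤n → *-congʳ (B-V-coeff n γ f i i≤n)) ⟩
      sumTo n (λ i → sumTo n (λ p → f p * binom (γ + natR (n ∸ p)) (n ∸ i)) * VinvMono n i k)
        ≈⟨ sumLt-reassoc (suc n) (suc n) f (λ i → VinvMono n i k) (λ p i → binom (γ + natR (n ∸ p)) (n ∸ i)) ⟩
      sumTo n (λ p → f p * sumTo n (λ i → binom (γ + natR (n ∸ p)) (n ∸ i) * VinvMono n i k)) ∎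

theorem6p2 : ∀ {c ℓ} (R : CommutativeRing c ℓ)
  (inv : ℕ → CommutativeRing.Carrier R) →
  let open CommutativeRing R
      open Ops R inv
  in (∀ m → natR (suc m) * inv (suc m) ≈ 1#) →
     ∀ (n : ℕ) (β : Carrier) (f : Poly) (k : ℕ) →
     U n (E n (natR n * β) (Uinv n f)) k
       ≈ Vinv n (B n (natR n * β) (V n f)) k
theorem6p2 R inv inv-correct n β f k =
  trans (U-E-Uinv R inv inv-correct n γ f k) (sym (Vinv-B-V R inv inv-correct n γ f k))
  where
  open CommutativeRing R using (Carrier; trans; sym; _*_)
  γ : Carrier
  γ = Ops.natR R inv n * β
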